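{- Let $\mathcal{M}=(\mathcal{W},\leq,\{R_a\}_{a\in\mathsf{A}},\mathcal{V})$ be an epistemic model based on an S5 frame, let $w\in\mathcal{W}$, $a\in\mathsf{A}$ and let $\varphi,\psi$ be formulae. Then $\mathcal{M},w\models K_a\varphi\to\psi$ if and only if $\mathcal{M},w\not\models K_a\varphi$ or $\mathcal{M},w\models\psi$.
   Context: Fix a finite non-empty set $\mathsf{A}$ of agents and a countable set $\mathrm{Prop}$ of atoms. Formulae: $\varphi ::= \bot \mid p \mid \varphi\wedge\varphi\mid\varphi\vee\varphi\mid\varphi\to\varphi\mid K_a\varphi\mid C\varphi$. An epistemic frame is $(\mathcal{W},\leq,\{R_a\}_{a\in\mathsf{A}})$ with $\mathcal{W}\neq\emptyset$, $\leq$ a partial order, $R_a\subseteq\mathcal{W}^2$, satisfying triangle confluence: $w\leq v$ and $vR_au$ imply $wR_au$; it is an S5 frame if each $R_a$ is an equivalence relation. An epistemic model adds a valuation $\mathcal{V}:\mathcal{W}\to\mathcal{P}(\mathrm{Prop})$ monotone in $\leq$. With $R=\bigcup_aR_a$ and $R^*$ its reflexive–transitive closure: $w\not\models\bot$; $w\models p$ iff $p\in\mathcal{V}(w)$; $\wedge,\vee$ as usual; $w\models\varphi\to\psi$ iff for all $v\geq w$, $v\models\varphi$ implies $v\models\psi$; $w\models K_a\varphi$ iff all $R_a$-successors satisfy $\varphi$; $w\models C\varphi$ iff all $R^*$-successors satisfy $\varphi$. -}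

module Defs where

open import Data.Nat using (ℕ; suc)
open import Data.Fin using (Fin)
open import Data.Product using (_×_; Σ; ∃)
open import Data.Sum using (_⊎_)
open import Data.Empty using (⊥)
open import Relation.Binary.Core using (Rel)
open import Relation.Binary.Structures using (IsPartialOrder; IsEquivalence)
open import Relation.Binary.PropositionalEquality using (_≡_)
open import Relation.Binary.Construct.Closure.ReflexiveTransitive using (Star)

-- Agents: a finite non-empty set, represented as Fin (suc n).
Agent : ℕ → Set
Agent n = Fin (suc n)

Prop : Set
Prop = ℕ

data Form (n : ℕ) : Set where
  ⊥'   : Form n
  atom : Prop → Form n
  _∧'_ : Form n → Form n → Form n
  _∨'_ : Form n → Form n → Form n
  _⇒_  : Form n → Form n → Form n
  K    : Agent n → Form n → Form n
  C    : Form n → Form n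

record Frame (n : ℕ) : Set₁ where
  field
    W         : Set
    inhabited : W
    _≤_       : Rel W _
    ≤-po      : IsPartialOrder _≡_ _≤_
    R         : Agent n → Rel W _
    confluence : ∀ {w v u} a → w ≤ v → R a v u → R a w u

IsS5 : ∀ {n} → Frame n → Set
IsS5 {n} F = (a : Agent n) → IsEquivalence (Frame.R F a)

record Model (n : ℕ) : Set₁ where
  field
    frame : Frame n
  open Frame frame public
  field
    V    : W → Prop → Set
    V-mono : ∀ {w v} p → w ≤ v → V w p → V v p

module _ {n : ℕ} (M : Model n) where
  open Model M

  Rall : Rel W _
  Rall w v = Σ (Agent n) (λ a → R a w v)

  infix 4 _⊨_
  _⊨_ : W → Form n → Set
  w ⊨ ⊥' = ⊥
  w ⊨ atom p = V w p
  w ⊨ (φ ∧' ψ) = (w ⊨ φ) × (w ⊨ ψ)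
  w ⊨ (φ ∨' ψ) = (w ⊨ φ) ⊎ (w ⊨ ψ)
  w ⊨ (φ ⇒ ψ) = ∀ v → w ≤ v → v ⊨ φ → v ⊨ ψ
  w ⊨ K a φ = ∀ v → R a w v → v ⊨ φ
  w ⊨ C φ = ∀ v → Star Rall w v → v ⊨ φ

{-# OPTIONS --safe #-}
-- Truth is persistent along ≤, and in an S5 frame K_a φ is moreover
-- downward closed: if w ≤ v then w R_a v by confluence and reflexivity,
-- so w and v have the same R_a-class.  Hence K_a φ holds at w iff it holds
-- at every (equivalently, some) v ≥ w, and with excluded middle the
-- intuitionistic implication K_a φ → ψ collapses to the classical one.
module Submission where

open import Defs
open import Data.Nat using (ℕ)
open import Data.Sum using (_⊎_; inj₁; inj₂)
open import Data.Product using (_,_)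
open import Data.Empty using (⊥-elim)
open import Relation.Nullary using (¬_; yes; no)
open import Function.Bundles using (_⇔_; mk⇔)
open import Level using (0ℓ)
open import Axiom.ExcludedMiddle using (ExcludedMiddle)
open import Relation.Binary.Structures using (IsPartialOrder; IsEquivalence)
open import Relation.Binary.Construct.Closure.ReflexiveTransitive using (ε; _◅_)

module _ {n : ℕ} (M : Model n) where
  open Model M
  open IsPartialOrder ≤-po using () renaming (refl to ≤-refl; trans to ≤-trans)

  ⊨-mono : ∀ φ {w v} → w ≤ v → _⊨_ M w φ → _⊨_ M v φ
  ⊨-mono ⊥'       w≤v ()
  ⊨-mono (atom p) w≤v w⊨p               = V-mono p w≤v w⊨p
  ⊨-mono (φ ∧' ψ) w≤v (w⊨φ , w⊨ψ)       = ⊨-mono φ w≤v w⊨φ , ⊨-mono ψ w≤v w⊨ψ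
  ⊨-mono (φ ∨' ψ) w≤v (inj₁ w⊨φ)        = inj₁ (⊨-mono φ w≤v w⊨φ)
  ⊨-mono (φ ∨' ψ) w≤v (inj₂ w⊨ψ)        = inj₂ (⊨-mono ψ w≤v w⊨ψ)
  ⊨-mono (φ ⇒ ψ)  w≤v w⊨φ⇒ψ u v≤u       = w⊨φ⇒ψ u (≤-trans w≤v v≤u)
  ⊨-mono (K a φ)  w≤v w⊨Kφ u vRu        = w⊨Kφ u (confluence a w≤v vRu)
  ⊨-mono (C φ)    w≤v w⊨Cφ u ε          = ⊨-mono φ w≤v (w⊨Cφ _ ε)
  ⊨-mono (C φ)    w≤v w⊨Cφ u ((b , vRx) ◅ x→u) =
    w⊨Cφ u ((b , confluence b w≤v vRx) ◅ x→u)

  ⊨K-antitone : IsS5 frame → ∀ a φ {w v} → w ≤ v → _⊨_ M v (K a φ) → _⊨_ M w (K a φ)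
  ⊨K-antitone s5 a φ {w} {v} w≤v v⊨Kφ u wRu = v⊨Kφ u (trans (sym wRv) wRu)
    where
    open IsEquivalence (s5 a)
    wRv : R a w v
    wRv = confluence a w≤v refl

  ⊨⇒-classical : ExcludedMiddle 0ℓ → ∀ χ ψ {w} →
    (∀ {v} → w ≤ v → _⊨_ M v χ → _⊨_ M w χ) →
    _⊨_ M w (χ ⇒ ψ) ⇔ ((¬ _⊨_ M w χ) ⊎ _⊨_ M w ψ)
  ⊨⇒-classical lem χ ψ {w} χ-down = mk⇔ to from
    where
    to : _⊨_ M w (χ ⇒ ψ) → (¬ _⊨_ M w χ) ⊎ _⊨_ M w ψ
    to w⊨χ⇒ψ with lem {_⊨_ M w χ}
    ... | yes w⊨χ = inj₂ (w⊨χ⇒ψ w ≤-refl w⊨χ)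
    ... | no  w⊭χ = inj₁ w⊭χ

    from : (¬ _⊨_ M w χ) ⊎ _⊨_ M w ψ → _⊨_ M w (χ ⇒ ψ)
    from (inj₁ w⊭χ) v w≤v v⊨χ = ⊥-elim (w⊭χ (χ-down w≤v v⊨χ))
    from (inj₂ w⊨ψ) v w≤v _   = ⊨-mono ψ w≤v w⊨ψ

mainTheorem3 : ExcludedMiddle 0ℓ → ∀ {n} (M : Model n) → IsS5 (Model.frame M) →
    (w : Model.W M) (a : Agent n) (φ ψ : Form n) →
    (_⊨_ M w (K a φ ⇒ ψ)) ⇔ ((¬ _⊨_ M w (K a φ)) ⊎ _⊨_ M w ψ)
mainTheorem3 lem M s5 w a φ ψ = ⊨⇒-classical M lem (K a φ) ψ (⊨K-antitone M s5 a φ)
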